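{- Let $q$ be a complex number with $q\neq 0,1$ and let $m,r$ be complex numbers. For every non-negative integer $n$, the $(q,r)$-Dowling numbers satisfy $$D_{m,r+1,q}(n)=\sum_{j=0}^n\binom{n}{j}D_{m,r,q}(j)\qquad\text{and}\qquad D_{m,r,q}(n)=\sum_{j=0}^n(-1)^{n-j}\binom{n}{j}D_{m,r+1,q}(j).$$
   Context: $[\ell]_q=\frac{q^\ell-1}{q-1}$. For complex $m,s$, the $(q,r)$-Whitney numbers of the second kind $W_{m,s,q}(n,k)$ are defined by $(ma^\dagger a+s)^n=\sum_{k=0}^{n}m^kW_{m,s,q}(n,k)(a^\dagger)^k a^k$ with $q$-boson operators $aa^\dagger-qa^\dagger a=1$; equivalently $W_{m,s,q}(0,0)=1$, $W_{m,s,q}(n,k)=0$ for $k<0$ or $k>n$, and $W_{m,s,q}(n+1,k)=q^{k-1}W_{m,s,q}(n,k-1)+(m[k]_q+s)W_{m,s,q}(n,k)$. The $(q,r)$-Dowling numbers are $D_{m,s,q}(n)=\sum_{k=0}^nW_{m,s,q}(n,k)$. -}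

module Defs where

open import Level using (Level)
open import Data.Nat using (ℕ; zero; suc)
open import Data.Nat.Combinatorics using (_C_)
open import Algebra.Bundles using (CommutativeRing)

-- All notions are defined over an arbitrary commutative ring R
-- (Agda's standard library has no complex numbers).
module Dowling {c ℓ : Level} (R : CommutativeRing c ℓ) where
  open CommutativeRing R hiding (zero)

  pow : Carrier → ℕ → Carrier
  pow x zero    = 1#
  pow x (suc n) = x * pow x n

  fromℕ : ℕ → Carrier
  fromℕ zero    = 0#
  fromℕ (suc n) = 1# + fromℕ n

  sumBelow : (ℕ → Carrier) → ℕ → Carrier
  sumBelow f zero    = 0#
  sumBelow f (suc n) = sumBelow f n + f n

  sumTo : (ℕ → Carrier) → ℕ → Carrier
  sumTo f n = sumBelow f (suc n)

  -- q-number [ℓ]_q = (q^ℓ - 1)/(q - 1) = 1 + q + ... + q^(ℓ-1)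
  qnum : Carrier → ℕ → Carrier
  qnum q l = sumBelow (pow q) l

  -- (q,r)-Whitney numbers of the second kind W_{m,s,q}(n,k), via the recurrence
  -- W(0,0)=1, W(0,k+1)=0, W(n+1,k) = q^(k-1) W(n,k-1) + (m[k]_q + s) W(n,k)
  -- (the first term absent for k = 0).
  W : (m s q : Carrier) → ℕ → ℕ → Carrier
  W m s q zero    zero    = 1#
  W m s q zero    (suc k) = 0#
  W m s q (suc n) zero    = (m * qnum q zero + s) * W m s q n zero
  W m s q (suc n) (suc k) =
    pow q k * W m s q n k + (m * qnum q (suc k) + s) * W m s q n (suc k)

  D : (m s q : Carrier) → ℕ → Carrier
  D m s q n = sumTo (W m s q n) n

  binom : ℕ → ℕ → Carrier
  binom n j = fromℕ (n C j)

module Submission where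

-- The (q,r)-Dowling numbers obey the binomial shift law
--
--   D_{m,s+c,q}(n) = Σ_{j=0}^{n} C(n,j) c^{n-j} D_{m,s,q}(j)        (★)
--
-- in any commutative ring and for any shift c; corollary7 is the two
-- instances c = 1 and (s,c) = (r+1,-1).  The law (★) is first proved for
-- the Whitney numbers W_{m,s,q}(n,k) with k fixed, by induction on n: the
-- binomial transform  B_c(n,X) = Σ_j C(n,j) c^{n-j} X(j)  satisfies the
-- Pascal-type recurrence  B_c(n+1,X) = B_c(n, X ∘ suc) + c·B_c(n,X),  which
-- matches the defining recurrence of W with the coefficient m[k]_q + s + c
-- split as (m[k]_q + s) + c.  Summing over k (an interchange of finite
-- sums, using that W(j,k) vanishes for k > j) gives (★).

open import Defs
open import Level using (Level)
open import Data.Nat using (ℕ; _∸_)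
open import Data.Product using (_×_)
open import Relation.Nullary using (¬_)
open import Algebra.Bundles using (CommutativeRing)

import Data.Nat as ℕ
import Data.Nat.Properties as ℕ
open import Data.Nat.Combinatorics using (_C_; nCk+nC[k+1]≡[n+1]C[k+1]; k>n⇒nCk≡0)
open import Data.Product using (_,_)
import Relation.Binary.PropositionalEquality as ≡
import Algebra.Properties.CommutativeSemigroup as CommSemigroupProperties

module DowlingShift {c ℓ : Level} (R : CommutativeRing c ℓ) where
  open CommutativeRing R hiding (zero)
  open Dowling R
  open import Relation.Binary.Reasoning.Setoid setoid
  open CommSemigroupProperties +-commutativeSemigroup
    using (interchange) renaming (x∙yz≈y∙xz to +-leftComm)
  open CommSemigroupProperties *-commutativeSemigroup
    using () renaming (x∙yz≈y∙xz to *-leftComm)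

  sumBelow-congᵇ : ∀ {f g} N → (∀ j → j ℕ.< N → f j ≈ g j) → sumBelow f N ≈ sumBelow g N
  sumBelow-congᵇ ℕ.zero    e = refl
  sumBelow-congᵇ (ℕ.suc N) e =
    +-cong (sumBelow-congᵇ N (λ j j<N → e j (ℕ.m<n⇒m<1+n j<N))) (e N (ℕ.n<1+n N))

  sumBelow-cong : ∀ {f g} N → (∀ j → f j ≈ g j) → sumBelow f N ≈ sumBelow g N
  sumBelow-cong N e = sumBelow-congᵇ N (λ j _ → e j)

  sumBelow-+ : ∀ f g N → sumBelow (λ j → f j + g j) N ≈ sumBelow f N + sumBelow g N
  sumBelow-+ f g ℕ.zero    = sym (+-identityʳ 0#)
  sumBelow-+ f g (ℕ.suc N) = trans (+-cong (sumBelow-+ f g N) refl) (interchange _ _ _ _)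

  sumBelow-* : ∀ a f N → sumBelow (λ j → a * f j) N ≈ a * sumBelow f N
  sumBelow-* a f ℕ.zero    = sym (zeroʳ a)
  sumBelow-* a f (ℕ.suc N) = trans (+-cong (sumBelow-* a f N) refl) (sym (distribˡ a _ _))

  sumBelow-0 : ∀ N → sumBelow (λ _ → 0#) N ≈ 0#
  sumBelow-0 ℕ.zero    = refl
  sumBelow-0 (ℕ.suc N) = trans (+-identityʳ _) (sumBelow-0 N)

  sumBelow-shift : ∀ f N → sumBelow f (ℕ.suc N) ≈ f 0 + sumBelow (λ j → f (ℕ.suc j)) N
  sumBelow-shift f ℕ.zero    = trans (+-identityˡ _) (sym (+-identityʳ _))
  sumBelow-shift f (ℕ.suc N) = trans (+-cong (sumBelow-shift f N) refl) (+-assoc _ _ _)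

  sumBelow-swap : ∀ (F : ℕ → ℕ → Carrier) N M →
    sumBelow (λ k → sumBelow (λ j → F j k) N) M ≈ sumBelow (λ j → sumBelow (λ k → F j k) M) N
  sumBelow-swap F N ℕ.zero    = sym (sumBelow-0 N)
  sumBelow-swap F N (ℕ.suc M) =
    trans (+-cong (sumBelow-swap F N M) refl)
          (sym (sumBelow-+ (λ j → sumBelow (λ k → F j k) M) (λ j → F j M) N))

  sumBelow-zeroTail : ∀ f N → (∀ j → N ℕ.≤ j → f j ≈ 0#) →
    ∀ d → sumBelow f (d ℕ.+ N) ≈ sumBelow f N
  sumBelow-zeroTail f N vanish ℕ.zero    = refl
  sumBelow-zeroTail f N vanish (ℕ.suc d) =
    trans (+-cong (sumBelow-zeroTail f N vanish d) (vanish (d ℕ.+ N) (ℕ.m≤n+m N d)))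
          (+-identityʳ _)

  fromℕ-+ : ∀ a b → fromℕ (a ℕ.+ b) ≈ fromℕ a + fromℕ b
  fromℕ-+ ℕ.zero    b = sym (+-identityˡ _)
  fromℕ-+ (ℕ.suc a) b = trans (+-cong refl (fromℕ-+ a b)) (sym (+-assoc _ _ _))

  binom-zero : ∀ n → binom n 0 ≈ 1#
  binom-zero n = +-identityʳ 1#

  binom-pascal : ∀ n j → binom (ℕ.suc n) (ℕ.suc j) ≈ binom n j + binom n (ℕ.suc j)
  binom-pascal n j =
    trans (reflexive (≡.cong fromℕ (≡.sym (nCk+nC[k+1]≡[n+1]C[k+1] n j))))
          (fromℕ-+ (n C j) (n C ℕ.suc j))

  binom-over : ∀ n → binom n (ℕ.suc n) ≈ 0#
  binom-over n = reflexive (≡.cong fromℕ (k>n⇒nCk≡0 (ℕ.n<1+n n)))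

  binomialTerm : Carrier → ℕ → (ℕ → Carrier) → ℕ → Carrier
  binomialTerm c n X j = binom n j * (pow c (n ∸ j) * X j)

  binomialTransform : Carrier → ℕ → (ℕ → Carrier) → Carrier
  binomialTransform c n X = sumTo (binomialTerm c n X) n

  binomialTransform-zero : ∀ c X → binomialTransform c 0 X ≈ X 0
  binomialTransform-zero c X =
    trans (+-identityˡ _)
          (trans (*-cong (binom-zero 0) refl) (trans (*-identityˡ _) (*-identityˡ _)))

  binomialTransform-+ : ∀ c n X Y →
    binomialTransform c n (λ j → X j + Y j) ≈ binomialTransform c n X + binomialTransform c n Y
  binomialTransform-+ c n X Y =
    trans (sumBelow-cong (ℕ.suc n) (λ j → trans (*-cong refl (distribˡ _ _ _)) (distribˡ _ _ _)))
          (sumBelow-+ _ _ (ℕ.suc n))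

  binomialTransform-* : ∀ c n a X →
    binomialTransform c n (λ j → a * X j) ≈ a * binomialTransform c n X
  binomialTransform-* c n a X =
    trans (sumBelow-cong (ℕ.suc n) (λ j →
             trans (*-cong refl (*-leftComm _ a _)) (*-leftComm _ a _)))
          (sumBelow-* a _ (ℕ.suc n))

  -- The part of B_c(n+1,X) coming from the C(n,j+1) half of Pascal's rule
  -- is c times the tail Σ_{j<n} of B_c(n,X): the top term has C(n,n+1) = 0,
  -- and each other term carries one surplus factor c.
  binomialTransform-upperHalf : ∀ c n X →
    sumBelow (λ j → binom n (ℕ.suc j) * (pow c (n ∸ j) * X (ℕ.suc j))) (ℕ.suc n)
      ≈ c * sumBelow (λ j → binomialTerm c n X (ℕ.suc j)) n
  binomialTransform-upperHalf c n X =
    trans (+-cong (sumBelow-congᵇ n surplusFactor) topTermVanishes)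
          (trans (+-identityʳ _) (sumBelow-* c _ n))
    where
    topTermVanishes : binom n (ℕ.suc n) * (pow c (n ∸ n) * X (ℕ.suc n)) ≈ 0#
    topTermVanishes = trans (*-cong (binom-over n) refl) (zeroˡ _)
    surplusFactor : ∀ j → j ℕ.< n →
      binom n (ℕ.suc j) * (pow c (n ∸ j) * X (ℕ.suc j)) ≈ c * binomialTerm c n X (ℕ.suc j)
    surplusFactor j j<n = begin
        binom n (ℕ.suc j) * (pow c (n ∸ j) * X (ℕ.suc j))
      ≡⟨ ≡.cong (λ e → binom n (ℕ.suc j) * (pow c e * X (ℕ.suc j))) (ℕ.+-∸-assoc 1 j<n) ⟩
        binom n (ℕ.suc j) * ((c * pow c (n ∸ ℕ.suc j)) * X (ℕ.suc j))
      ≈⟨ *-cong refl (*-assoc _ _ _) ⟩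
        binom n (ℕ.suc j) * (c * (pow c (n ∸ ℕ.suc j) * X (ℕ.suc j)))
      ≈⟨ *-leftComm _ c _ ⟩
        c * binomialTerm c n X (ℕ.suc j)
      ∎

  binomialTransform-pascal : ∀ c n X →
    binomialTransform c (ℕ.suc n) X
      ≈ binomialTransform c n (λ j → X (ℕ.suc j)) + c * binomialTransform c n X
  binomialTransform-pascal c n X = begin
      binomialTransform c (ℕ.suc n) X
    ≈⟨ sumBelow-shift (binomialTerm c (ℕ.suc n) X) (ℕ.suc n) ⟩
      binomialTerm c (ℕ.suc n) X 0 + sumBelow (λ j → binomialTerm c (ℕ.suc n) X (ℕ.suc j)) (ℕ.suc n)
    ≈⟨ +-cong refl (sumBelow-cong (ℕ.suc n) splitTerm) ⟩
      binomialTerm c (ℕ.suc n) X 0 + sumBelow (λ j → lower j + upper j) (ℕ.suc n)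
    ≈⟨ +-cong firstTerm (sumBelow-+ lower upper (ℕ.suc n)) ⟩
      c * H 0 + (binomialTransform c n (λ j → X (ℕ.suc j)) + sumBelow upper (ℕ.suc n))
    ≈⟨ +-cong refl (+-cong refl (binomialTransform-upperHalf c n X)) ⟩
      c * H 0 + (binomialTransform c n (λ j → X (ℕ.suc j)) + c * sumBelow (λ j → H (ℕ.suc j)) n)
    ≈⟨ +-leftComm _ _ _ ⟩
      binomialTransform c n (λ j → X (ℕ.suc j)) + (c * H 0 + c * sumBelow (λ j → H (ℕ.suc j)) n)
    ≈⟨ +-cong refl (trans (sym (distribˡ c _ _)) (*-cong refl (sym (sumBelow-shift H n)))) ⟩
      binomialTransform c n (λ j → X (ℕ.suc j)) + c * binomialTransform c n X
    ∎
    where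
    H : ℕ → Carrier
    H = binomialTerm c n X
    -- Pascal's rule splits the term of index j+1 into these two parts.
    lower upper : ℕ → Carrier
    lower j = binom n j * (pow c (n ∸ j) * X (ℕ.suc j))
    upper j = binom n (ℕ.suc j) * (pow c (n ∸ j) * X (ℕ.suc j))
    firstTerm : binomialTerm c (ℕ.suc n) X 0 ≈ c * H 0
    firstTerm = begin
        binom (ℕ.suc n) 0 * ((c * pow c n) * X 0)
      ≈⟨ trans (*-cong (binom-zero (ℕ.suc n)) refl) (*-identityˡ _) ⟩
        (c * pow c n) * X 0
      ≈⟨ *-assoc _ _ _ ⟩
        c * (pow c n * X 0)
      ≈⟨ *-cong refl (sym (trans (*-cong (binom-zero n) refl) (*-identityˡ _))) ⟩
        c * H 0
      ∎
    splitTerm : ∀ j → binomialTerm c (ℕ.suc n) X (ℕ.suc j) ≈ lower j + upper j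
    splitTerm j = trans (*-cong (binom-pascal n j) refl) (distribʳ _ _ _)

  module ShiftLaw (m q : Carrier) where

    whitney-cong : ∀ {s s'} → s ≈ s' → ∀ n k → W m s q n k ≈ W m s' q n k
    whitney-cong e ℕ.zero    ℕ.zero    = refl
    whitney-cong e ℕ.zero    (ℕ.suc k) = refl
    whitney-cong e (ℕ.suc n) ℕ.zero    = *-cong (+-cong refl e) (whitney-cong e n ℕ.zero)
    whitney-cong e (ℕ.suc n) (ℕ.suc k) =
      +-cong (*-cong refl (whitney-cong e n k))
             (*-cong (+-cong refl e) (whitney-cong e n (ℕ.suc k)))

    dowling-cong : ∀ {s s'} → s ≈ s' → ∀ n → D m s q n ≈ D m s' q n
    dowling-cong e n = sumBelow-cong (ℕ.suc n) (whitney-cong e n)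

    whitney-vanish : ∀ s n k → n ℕ.< k → W m s q n k ≈ 0#
    whitney-vanish s ℕ.zero    (ℕ.suc k) n<k          = refl
    whitney-vanish s (ℕ.suc n) (ℕ.suc k) (ℕ.s≤s n<k) =
      trans (+-cong (*-cong refl (whitney-vanish s n k n<k))
                    (*-cong refl (whitney-vanish s n (ℕ.suc k) (ℕ.m<n⇒m<1+n n<k))))
            (trans (+-cong (zeroʳ _) (zeroʳ _)) (+-identityʳ 0#))

    whitney-rowSum : ∀ s j n → j ℕ.≤ n → sumTo (W m s q j) n ≈ D m s q j
    whitney-rowSum s j n j≤n = begin
        sumBelow (W m s q j) (ℕ.suc n)
      ≡⟨ ≡.cong (sumBelow (W m s q j)) (≡.sym (ℕ.m∸n+n≡m (ℕ.s≤s j≤n))) ⟩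
        sumBelow (W m s q j) ((ℕ.suc n ∸ ℕ.suc j) ℕ.+ ℕ.suc j)
      ≈⟨ sumBelow-zeroTail (W m s q j) (ℕ.suc j) (whitney-vanish s j) (ℕ.suc n ∸ ℕ.suc j) ⟩
        D m s q j
      ∎

    coefficient-split : ∀ a s c B → (a + (s + c)) * B ≈ (a + s) * B + c * B
    coefficient-split a s c B = trans (*-cong (sym (+-assoc a s c)) refl) (distribʳ B _ _)

    -- Whitney shift law: W_{m,s+c,q}(n,k) = Σ_j C(n,j) c^{n-j} W_{m,s,q}(j,k).
    -- Both sides satisfy the recurrence of W in n, by binomialTransform-pascal.
    whitney-shift : ∀ s c n k → W m (s + c) q n k ≈ binomialTransform c n (λ j → W m s q j k)
    whitney-shift s c ℕ.zero ℕ.zero    = sym (binomialTransform-zero c (λ j → W m s q j 0))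
    whitney-shift s c ℕ.zero (ℕ.suc k) = sym (binomialTransform-zero c (λ j → W m s q j (ℕ.suc k)))
    whitney-shift s c (ℕ.suc n) ℕ.zero = begin
        (m * qnum q 0 + (s + c)) * W m (s + c) q n 0
      ≈⟨ *-cong refl (whitney-shift s c n 0) ⟩
        (m * qnum q 0 + (s + c)) * B₀
      ≈⟨ coefficient-split _ s c B₀ ⟩
        (m * qnum q 0 + s) * B₀ + c * B₀
      ≈⟨ +-cong (sym (binomialTransform-* c n _ _)) refl ⟩
        binomialTransform c n (λ j → W m s q (ℕ.suc j) 0) + c * B₀
      ≈⟨ sym (binomialTransform-pascal c n _) ⟩
        binomialTransform c (ℕ.suc n) (λ j → W m s q j 0)
      ∎
      where
      B₀ = binomialTransform c n (λ j → W m s q j 0)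
    whitney-shift s c (ℕ.suc n) (ℕ.suc k) = begin
        pow q k * W m (s + c) q n k + (m * qnum q (ℕ.suc k) + (s + c)) * W m (s + c) q n (ℕ.suc k)
      ≈⟨ +-cong (*-cong refl (whitney-shift s c n k)) (*-cong refl (whitney-shift s c n (ℕ.suc k))) ⟩
        pow q k * Bₖ + (m * qnum q (ℕ.suc k) + (s + c)) * Bₖ₊₁
      ≈⟨ trans (+-cong refl (coefficient-split _ s c Bₖ₊₁)) (sym (+-assoc _ _ _)) ⟩
        (pow q k * Bₖ + (m * qnum q (ℕ.suc k) + s) * Bₖ₊₁) + c * Bₖ₊₁
      ≈⟨ +-cong (sym (trans (binomialTransform-+ c n _ _)
                            (+-cong (binomialTransform-* c n _ _) (binomialTransform-* c n _ _)))) refl ⟩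
        binomialTransform c n (λ j → W m s q (ℕ.suc j) (ℕ.suc k)) + c * Bₖ₊₁
      ≈⟨ sym (binomialTransform-pascal c n _) ⟩
        binomialTransform c (ℕ.suc n) (λ j → W m s q j (ℕ.suc k))
      ∎
      where
      Bₖ   = binomialTransform c n (λ j → W m s q j k)
      Bₖ₊₁ = binomialTransform c n (λ j → W m s q j (ℕ.suc k))

    -- Dowling shift law (★): D_{m,s+c,q}(n) = Σ_j C(n,j) c^{n-j} D_{m,s,q}(j).
    -- Sum the Whitney shift law over k ≤ n and interchange the two sums.
    dowling-shift : ∀ s c n → D m (s + c) q n ≈ binomialTransform c n (D m s q)
    dowling-shift s c n = begin
        D m (s + c) q n
      ≈⟨ sumBelow-cong (ℕ.suc n) (whitney-shift s c n) ⟩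
        sumBelow (λ k → sumBelow (λ j → T j k) (ℕ.suc n)) (ℕ.suc n)
      ≈⟨ sumBelow-swap T (ℕ.suc n) (ℕ.suc n) ⟩
        sumBelow (λ j → sumBelow (λ k → T j k) (ℕ.suc n)) (ℕ.suc n)
      ≈⟨ sumBelow-cong (ℕ.suc n) (λ j →
           trans (sumBelow-* (binom n j) _ (ℕ.suc n)) (*-cong refl (sumBelow-* _ _ (ℕ.suc n)))) ⟩
        sumBelow (λ j → binom n j * (pow c (n ∸ j) * sumTo (W m s q j) n)) (ℕ.suc n)
      ≈⟨ sumBelow-congᵇ (ℕ.suc n) (λ j j<1+n →
           *-cong refl (*-cong refl (whitney-rowSum s j n (ℕ.≤-pred j<1+n)))) ⟩
        binomialTransform c n (D m s q)
      ∎
      where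
      T : ℕ → ℕ → Carrier
      T j k = binomialTerm c n (λ i → W m s q i k) j

  pow-one : ∀ k → pow 1# k ≈ 1#
  pow-one ℕ.zero    = refl
  pow-one (ℕ.suc k) = trans (*-identityˡ _) (pow-one k)

  -- r = (r + 1) - 1, so D_{m,r,q} is a shift of D_{m,r+1,q} by -1.
  add-then-subtract-one : ∀ r → r ≈ (r + 1#) + - 1#
  add-then-subtract-one r =
    sym (trans (+-assoc r 1# (- 1#)) (trans (+-cong refl (-‿inverseʳ 1#)) (+-identityʳ r)))

  corollary : (q m r : Carrier) → ¬ (q ≈ 0#) → ¬ (q ≈ 1#) → (n : ℕ) →
       (D m (r + 1#) q n ≈ sumTo (λ j → binom n j * D m r q j) n)
       × (D m r q n ≈ sumTo (λ j → pow (- 1#) (n ∸ j) * (binom n j * D m (r + 1#) q j)) n)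
  corollary q m r _ _ n = shiftByOne , shiftByMinusOne
    where
    open ShiftLaw m q
    shiftByOne : D m (r + 1#) q n ≈ sumTo (λ j → binom n j * D m r q j) n
    shiftByOne =
      trans (dowling-shift r 1# n)
            (sumBelow-cong (ℕ.suc n) (λ j →
               *-cong refl (trans (*-cong (pow-one (n ∸ j)) refl) (*-identityˡ _))))
    shiftByMinusOne : D m r q n ≈ sumTo (λ j → pow (- 1#) (n ∸ j) * (binom n j * D m (r + 1#) q j)) n
    shiftByMinusOne =
      trans (dowling-cong (add-then-subtract-one r) n)
            (trans (dowling-shift (r + 1#) (- 1#) n)
                   (sumBelow-cong (ℕ.suc n) (λ j → *-leftComm _ _ _)))

corollary7 : {c ℓ : Level} (R : CommutativeRing c ℓ) →
    let open CommutativeRing R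
        open Dowling R
    in (q m r : Carrier) → ¬ (q ≈ 0#) → ¬ (q ≈ 1#) → (n : ℕ) →
       (D m (r + 1#) q n ≈ sumTo (λ j → binom n j * D m r q j) n)
       × (D m r q n ≈ sumTo (λ j → pow (- 1#) (n ∸ j) * (binom n j * D m (r + 1#) q j)) n)
corollary7 R = DowlingShift.corollary R
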